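{- Let $N\ge1$ be an integer and let $\Lambda\subset\mathbb{C}\cong\mathbb{R}^2$ be the lattice generated by $1$ and $\theta=\sqrt{ -N}$ (a lattice with rectangular Voronoi cell). For $\alpha=a+b\sqrt{ -N}$ with $a,b\in\mathbb{Z}$, $\alpha\neq0$, the sublattice $\alpha\Lambda$ is clean if and only if $\alpha\bar\alpha=a^2+Nb^2$ is odd (equivalently, $a+Nb$ is odd).
   Context: A sublattice $\Lambda'\subseteq\Lambda$ is clean if the boundaries of the Voronoi cells of $\Lambda'$ (in $\mathbb{R}^2$) contain no point of $\Lambda$. -}

module Defs where

open import Data.Nat using (ℕ)
open import Data.Integer using (ℤ; +_; _+_; _-_; _*_; _≤_)
open import Data.Product using (_×_; _,_; ∃; Σ)
open import Relation.Binary.PropositionalEquality using (_≡_)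

-- A point x + y·√(-N) of the lattice Λ = ℤ + ℤ√(-N) ⊂ ℂ ≅ ℝ², stored as (x , y).
Pt : Set
Pt = ℤ × ℤ

-- Multiplication in ℤ[√(-N)]: (a + b√-N)(c + d√-N) = (ac - N bd) + (ad + bc)√-N.
mul : ℕ → Pt → Pt → Pt
mul N (a , b) (c , d) = (a * c - (+ N) * (b * d)) , (a * d + b * c)

normSq : ℕ → Pt → ℤ
normSq N (x , y) = x * x + (+ N) * (y * y)

sub : Pt → Pt → Pt
sub (x , y) (u , v) = (x - u) , (y - v)

dist² : ℕ → Pt → Pt → ℤ
dist² N p q = normSq N (sub p q)

InSub : ℕ → Pt → Pt → Set
InSub N α p = ∃ λ μ → mul N α μ ≡ p

InVoronoiCell : ℕ → Pt → Pt → Pt → Set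
InVoronoiCell N α p x = InSub N α p × (∀ r → InSub N α r → dist² N x p ≤ dist² N x r)

OnVoronoiBoundary : ℕ → Pt → Pt → Set
OnVoronoiBoundary N α x =
  Σ Pt λ p → Σ Pt λ q → (p ≡ q → Data.Empty.⊥) × InVoronoiCell N α p x × InVoronoiCell N α q x
  where import Data.Empty

Clean : ℕ → Pt → Set
Clean N α = ∀ (x : Pt) → OnVoronoiBoundary N α x → Data.Empty.⊥
  where import Data.Empty

{-# OPTIONS --safe #-}
module Submission where

-- Multiplication by ᾱ sends αμ to nμ, where n = αᾱ = a² + N b², and multiplies squared distances
-- by n.  So x lies in the Voronoi cell of αμ exactly when nμ is a point of nΛ closest to ᾱx, and
-- since the norm u² + N v² splits over the coordinates, exactly when μ₁ and μ₂ are nearest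
-- multiples of n to the two coordinates of ᾱx.  For odd n an integer has only one nearest
-- multiple of n, so no point of Λ lies in two cells.  For even n = 2h one of αθ, α(1 + θ), say
-- αμ, lies in 2Λ; its half x satisfies ᾱx = hμ, which in each coordinate is as close to 0 as
-- to 2hμ, so x lies on the common boundary of the cells of 0 and αμ.

open import Defs
open import Data.Nat using (ℕ; _≥_)
open import Data.Integer using (ℤ; +_; _+_; _*_)
open import Data.Integer.Divisibility using (_∣_)
open import Data.Product using (_,_)
open import Relation.Binary.PropositionalEquality using (_≡_)
open import Relation.Nullary using (¬_)
open import Function.Bundles using (_⇔_)

import Data.Nat as ℕ
open import Data.Nat.Divisibility using (∣1⇒≡1)
open import Data.Integer
  using (_-_; -_; _≤_; _<_; 0ℤ; 1ℤ; +0; +[1+_]; -[1+_]; +≤+; +<+; _≟_)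
open import Data.Integer.Base using (NonZero; ≢-nonZero; >-nonZero; positive; nonNegative)
import Data.Integer.Divisibility.Signed as Signed
open import Data.Integer.DivMod using (_%ℕ_; _/ℕ_; n%ℕd<d; a≡a%ℕn+[a/ℕn]*n)
open import Data.Integer.Properties
open import Data.Integer.Tactic.RingSolver using (solve-∀)
open import Data.Product using (_×_; ∃; proj₁; proj₂)
open import Data.Sum using (_⊎_; inj₁; inj₂; [_,_]′)
open import Function.Base using (_∘_)
open import Function.Bundles using (mk⇔)
open import Relation.Binary.PropositionalEquality
  using (refl; sym; trans; cong; cong₂; subst; subst₂; _≢_; module ≡-Reasoning)
open import Relation.Nullary using (yes; no; contradiction)

sq : ℤ → ℤ
sq z = z * z

sq-nonneg : ∀ z → 0ℤ ≤ sq z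
sq-nonneg +0       = +≤+ ℕ.z≤n
sq-nonneg +[1+ n ] = +≤+ ℕ.z≤n
sq-nonneg -[1+ n ] = +≤+ ℕ.z≤n

sq-pos : ∀ {z} → z ≢ 0ℤ → 0ℤ < sq z
sq-pos {+0}       z≢0 = contradiction refl z≢0
sq-pos {+[1+ n ]} _   = +<+ ℕ.z<s
sq-pos { -[1+ n ]} _  = +<+ ℕ.z<s

sq≤0⇒≡0 : ∀ z → sq z ≤ 0ℤ → z ≡ 0ℤ
sq≤0⇒≡0 z sq≤0 with z ≟ 0ℤ
... | yes z≡0 = z≡0
... | no  z≢0 = contradiction sq≤0 (<⇒≱ (sq-pos z≢0))

+-cancelʳ-≤ : ∀ {i j} k → i + k ≤ j + k → i ≤ j
+-cancelʳ-≤ {i} {j} k i+k≤j+k = subst₂ _≤_ (cancel i) (cancel j) (+-monoˡ-≤ (- k) i+k≤j+k)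
  where
  cancel : ∀ x → x + k - k ≡ x
  cancel x = trans (+-assoc x k (- k)) (trans (cong (λ y → x + y) (+-inverseʳ k)) (+-identityʳ x))

+-cancelˡ-≤ : ∀ {i j} k → k + i ≤ k + j → i ≤ j
+-cancelˡ-≤ {i} {j} k k+i≤k+j = +-cancelʳ-≤ k (subst₂ _≤_ (+-comm k i) (+-comm k j) k+i≤k+j)

data Parity : ℤ → Set where
  even : ∀ k → Parity (+ 2 * k)
  odd  : ∀ k → Parity (+ 2 * k + 1ℤ)

parity : ∀ z → Parity z
parity z with z %ℕ 2 | n%ℕd<d z 2 | a≡a%ℕn+[a/ℕn]*n z 2
... | 0 | _ | z≡r+2q = subst Parity (sym (trans z≡r+2q (reorder (z /ℕ 2)))) (even (z /ℕ 2))
  where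
  reorder : ∀ q → + 0 + q * + 2 ≡ + 2 * q
  reorder = solve-∀
... | 1 | _ | z≡r+2q = subst Parity (sym (trans z≡r+2q (reorder (z /ℕ 2)))) (odd (z /ℕ 2))
  where
  reorder : ∀ q → + 1 + q * + 2 ≡ + 2 * q + 1ℤ
  reorder = solve-∀
... | ℕ.suc (ℕ.suc _) | ℕ.s≤s (ℕ.s≤s ()) | _

2∣even : ∀ k → + 2 ∣ + 2 * k
2∣even k = Signed.∣⇒∣ᵤ (Signed.divides k (*-comm (+ 2) k))

odd⇒2∤ : ∀ {n} k → n ≡ + 2 * k + 1ℤ → ¬ (+ 2 ∣ n)
odd⇒2∤ k refl 2∣odd = contradiction (∣1⇒≡1 (Signed.∣⇒∣ᵤ 2∣1)) λ ()
  where
  2∣1 : + 2 Signed.∣ 1ℤ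
  2∣1 = Signed.∣m+n∣m⇒∣n {m = + 2 * k} (Signed.∣ᵤ⇒∣ 2∣odd) (Signed.∣ᵤ⇒∣ (2∣even k))

odd≢0 : ∀ k → + 2 * k + 1ℤ ≢ 0ℤ
odd≢0 k odd≡0 = odd⇒2∤ k refl (subst (+ 2 ∣_) (sym odd≡0) (2∣even 0ℤ))

record NearestMultiple (n w m : ℤ) : Set where
  constructor nearestMultiple
  field
    minimal : ∀ k → sq (w - n * m) ≤ sq (w - n * k)

open NearestMultiple

nearestMultiple-of-multiple : ∀ n .{{_ : NonZero n}} {s m} → NearestMultiple n (n * s) m → m ≡ s
nearestMultiple-of-multiple n {s} {m} nearest =
  sym (*-cancelˡ-≡ n s m (i-j≡0⇒i≡j (n * s) (n * m) ns-nm≡0))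
  where
  ns-nm≡0 : n * s - n * m ≡ 0ℤ
  ns-nm≡0 = sq≤0⇒≡0 _ (subst (λ z → sq (n * s - n * m) ≤ sq z) (+-inverseʳ (n * s)) (minimal nearest s))

-- A tie puts w halfway between n m₁ and n m₂; for odd n that midpoint is itself a multiple of n.
nearestMultiple-unique-odd : ∀ j {w m₁ m₂} →
  NearestMultiple (+ 2 * j + 1ℤ) w m₁ → NearestMultiple (+ 2 * j + 1ℤ) w m₂ → m₁ ≡ m₂
nearestMultiple-unique-odd j {w} {m₁} {m₂} near₁ near₂ =
  [ equal-distances , opposite-distances ]′ (i*j≡0⇒i≡0∨j≡0 (d₁ - d₂) difference-of-squares≡0)
  where
  open ≡-Reasoning
  n = + 2 * j + 1ℤ
  instance
    n≢0 : NonZero n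
    n≢0 = ≢-nonZero (odd≢0 j)
  d₁ = w - n * m₁
  d₂ = w - n * m₂

  difference-of-squares : ∀ x y → (x - y) * (x + y) ≡ x * x - y * y
  difference-of-squares = solve-∀

  difference-of-squares≡0 : (d₁ - d₂) * (d₁ + d₂) ≡ 0ℤ
  difference-of-squares≡0 = begin
    (d₁ - d₂) * (d₁ + d₂) ≡⟨ difference-of-squares d₁ d₂ ⟩
    sq d₁ - sq d₂         ≡⟨ cong (_- sq d₂) (≤-antisym (minimal near₁ m₂) (minimal near₂ m₁)) ⟩
    sq d₂ - sq d₂         ≡⟨ +-inverseʳ (sq d₂) ⟩
    0ℤ                    ∎

  d₁-d₂≡ : ∀ n w m₁ m₂ → (w - n * m₁) - (w - n * m₂) ≡ n * m₂ - n * m₁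
  d₁-d₂≡ = solve-∀

  equal-distances : d₁ - d₂ ≡ 0ℤ → m₁ ≡ m₂
  equal-distances d₁-d₂≡0 = sym (*-cancelˡ-≡ n m₂ m₁ (i-j≡0⇒i≡j (n * m₂) (n * m₁) nm₂-nm₁≡0))
    where
    nm₂-nm₁≡0 : n * m₂ - n * m₁ ≡ 0ℤ
    nm₂-nm₁≡0 = trans (sym (d₁-d₂≡ n w m₁ m₂)) d₁-d₂≡0

  midpoint≡ : ∀ j w m₁ m₂ → let n = + 2 * j + 1ℤ in
    w - n * (w - j * (m₁ + m₂)) ≡ - j * ((w - n * m₁) + (w - n * m₂))
  midpoint≡ = solve-∀

  opposite-distances : d₁ + d₂ ≡ 0ℤ → m₁ ≡ m₂
  opposite-distances d₁+d₂≡0 = trans (m≡s near₁) (sym (m≡s near₂))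
    where
    s = w - j * (m₁ + m₂)
    w≡ns : w ≡ n * s
    w≡ns = i-j≡0⇒i≡j w (n * s) (begin
      w - n * s             ≡⟨ midpoint≡ j w m₁ m₂ ⟩
      - j * (d₁ + d₂)       ≡⟨ cong (- j *_) d₁+d₂≡0 ⟩
      - j * 0ℤ              ≡⟨ *-zeroʳ (- j) ⟩
      0ℤ                    ∎)
    m≡s : ∀ {m} → NearestMultiple n w m → m ≡ s
    m≡s near = nearestMultiple-of-multiple n (subst (λ v → NearestMultiple n v _) w≡ns near)

nearestMultiple-unique : ∀ {n w m₁ m₂} → ¬ (+ 2 ∣ n) →
  NearestMultiple n w m₁ → NearestMultiple n w m₂ → m₁ ≡ m₂
nearestMultiple-unique {n} {w} 2∤n with parity n
... | even k = contradiction (2∣even k) 2∤n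
... | odd j  = nearestMultiple-unique-odd j {w}

Bit : ℤ → Set
Bit e = e ≡ 0ℤ ⊎ e ≡ 1ℤ

1≤sq-odd : ∀ k → 1ℤ ≤ sq (+ 2 * k + 1ℤ)
1≤sq-odd k = i<j⇒suc[i]≤j (sq-pos (odd≢0 k))

-- h - 2hk = h (1 - 2k), and the odd factor 1 - 2k has square at least 1.
nearestMultiple-half : ∀ h {e} → Bit e →
  NearestMultiple (+ 2 * h) (h * e) 0ℤ × NearestMultiple (+ 2 * h) (h * e) e
nearestMultiple-half h (inj₁ refl) = exact , exact
  where
  at-zero : ∀ h → (h * 0ℤ - + 2 * h * 0ℤ) * (h * 0ℤ - + 2 * h * 0ℤ) ≡ 0ℤ
  at-zero = solve-∀
  exact : NearestMultiple (+ 2 * h) (h * 0ℤ) 0ℤ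
  exact = nearestMultiple λ k →
    subst (_≤ sq (h * 0ℤ - + 2 * h * k)) (sym (at-zero h)) (sq-nonneg (h * 0ℤ - + 2 * h * k))
nearestMultiple-half h (inj₂ refl) = nearest-at 0ℤ (at-zero h) , nearest-at 1ℤ (at-one h)
  where
  at-zero : ∀ h → (h * 1ℤ - + 2 * h * 0ℤ) * (h * 1ℤ - + 2 * h * 0ℤ) ≡ h * h
  at-zero = solve-∀
  at-one : ∀ h → (h * 1ℤ - + 2 * h * 1ℤ) * (h * 1ℤ - + 2 * h * 1ℤ) ≡ h * h
  at-one = solve-∀
  factor : ∀ h k →
    (h * 1ℤ - + 2 * h * k) * (h * 1ℤ - + 2 * h * k) ≡ h * h * ((+ 2 * - k + 1ℤ) * (+ 2 * - k + 1ℤ))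
  factor = solve-∀

  sq-h≤ : ∀ k → sq h ≤ sq (h * 1ℤ - + 2 * h * k)
  sq-h≤ k = subst₂ _≤_ (*-identityʳ (sq h)) (sym (factor h k))
    (*-monoˡ-≤-nonNeg (sq h) {{nonNegative (sq-nonneg h)}} (1≤sq-odd (- k)))

  nearest-at : ∀ m → sq (h * 1ℤ - + 2 * h * m) ≡ sq h → NearestMultiple (+ 2 * h) (h * 1ℤ) m
  nearest-at m sq≡ = nearestMultiple λ k → subst (_≤ sq (h * 1ℤ - + 2 * h * k)) (sym sq≡) (sq-h≤ k)

conj : Pt → Pt
conj (a , b) = a , - b

scale : ℤ → Pt → Pt
scale k (x , y) = k * x , k * y

scale-injective : ∀ k .{{_ : NonZero k}} {μ ν} → scale k μ ≡ scale k ν → μ ≡ ν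
scale-injective k {μ₁ , μ₂} {ν₁ , ν₂} kμ≡kν =
  cong₂ _,_ (*-cancelˡ-≡ k μ₁ ν₁ (cong proj₁ kμ≡kν)) (*-cancelˡ-≡ k μ₂ ν₂ (cong proj₂ kμ≡kν))

scale-* : ∀ k l μ → scale (k * l) μ ≡ scale k (scale l μ)
scale-* k l (μ₁ , μ₂) = cong₂ _,_ (*-assoc k l μ₁) (*-assoc k l μ₂)

mul-scale : ∀ N α k x → mul N α (scale k x) ≡ scale k (mul N α x)
mul-scale N (a , b) k (x₁ , x₂) = cong₂ _,_ (first (+ N) a b k x₁ x₂) (second a b k x₁ x₂)
  where
  first : ∀ c a b k x₁ x₂ → a * (k * x₁) - c * (b * (k * x₂)) ≡ k * (a * x₁ - c * (b * x₂))
  first = solve-∀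
  second : ∀ a b k x₁ x₂ → a * (k * x₂) + b * (k * x₁) ≡ k * (a * x₂ + b * x₁)
  second = solve-∀

mul-conj-mul : ∀ N α μ → mul N (conj α) (mul N α μ) ≡ scale (normSq N α) μ
mul-conj-mul N (a , b) (m₁ , m₂) = cong₂ _,_ (first (+ N) a b m₁ m₂) (second (+ N) a b m₁ m₂)
  where
  first : ∀ c a b m₁ m₂ →
    a * (a * m₁ - c * (b * m₂)) - c * (- b * (a * m₂ + b * m₁)) ≡ (a * a + c * (b * b)) * m₁
  first = solve-∀
  second : ∀ c a b m₁ m₂ →
    a * (a * m₂ + b * m₁) + - b * (a * m₁ - c * (b * m₂)) ≡ (a * a + c * (b * b)) * m₂
  second = solve-∀

dist²-mul-conj : ∀ N α x μ →
  normSq N α * dist² N x (mul N α μ) ≡ dist² N (mul N (conj α) x) (scale (normSq N α) μ)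
dist²-mul-conj N (a , b) (x₁ , x₂) (m₁ , m₂) = identity (+ N) a b x₁ x₂ m₁ m₂
  where
  identity : ∀ c a b x₁ x₂ m₁ m₂ →
    let n  = a * a + c * (b * b)
        y₁ = x₁ - (a * m₁ - c * (b * m₂))
        y₂ = x₂ - (a * m₂ + b * m₁)
        z₁ = (a * x₁ - c * (- b * x₂)) - n * m₁
        z₂ = (a * x₂ + - b * x₁) - n * m₂
    in n * (y₁ * y₁ + c * (y₂ * y₂)) ≡ z₁ * z₁ + c * (z₂ * z₂)
  identity = solve-∀

mul-injective : ∀ N α .{{_ : NonZero (normSq N α)}} {μ ν} → mul N α μ ≡ mul N α ν → μ ≡ ν
mul-injective N α {μ} {ν} αμ≡αν = scale-injective (normSq N α) (begin
  scale (normSq N α) μ        ≡⟨ mul-conj-mul N α μ ⟨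
  mul N (conj α) (mul N α μ)  ≡⟨ cong (mul N (conj α)) αμ≡αν ⟩
  mul N (conj α) (mul N α ν)  ≡⟨ mul-conj-mul N α ν ⟩
  scale (normSq N α) ν        ∎)
  where open ≡-Reasoning

mul-conj-half : ∀ N α {x μ h} → scale (+ 2) x ≡ mul N α μ → normSq N α ≡ + 2 * h →
  mul N (conj α) x ≡ scale h μ
mul-conj-half N α {x} {μ} {h} 2x≡αμ n≡2h = scale-injective (+ 2) (begin
  scale (+ 2) (mul N (conj α) x)  ≡⟨ mul-scale N (conj α) (+ 2) x ⟨
  mul N (conj α) (scale (+ 2) x)  ≡⟨ cong (mul N (conj α)) 2x≡αμ ⟩
  mul N (conj α) (mul N α μ)      ≡⟨ mul-conj-mul N α μ ⟩
  scale (normSq N α) μ            ≡⟨ cong (λ n → scale n μ) n≡2h ⟩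
  scale (+ 2 * h) μ               ≡⟨ scale-* (+ 2) h μ ⟩
  scale (+ 2) (scale h μ)         ∎)
  where open ≡-Reasoning

+N*sq-nonneg : ∀ N z → 0ℤ ≤ + N * sq z
+N*sq-nonneg N z = subst (_≤ + N * sq z) (*-zeroʳ (+ N)) (*-monoˡ-≤-nonNeg (+ N) (sq-nonneg z))

normSq-nonneg : ∀ N α → 0ℤ ≤ normSq N α
normSq-nonneg N (a , b) = +-mono-≤ (sq-nonneg a) (+N*sq-nonneg N b)

normSq-pos : ∀ N .{{_ : ℕ.NonZero N}} α → α ≢ (0ℤ , 0ℤ) → 0ℤ < normSq N α
normSq-pos N@(ℕ.suc _) (a , b) α≢0 with a ≟ 0ℤ | b ≟ 0ℤ
... | yes refl | yes refl = contradiction refl α≢0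
... | no a≢0   | _        =
  <-≤-trans (sq-pos a≢0) (i≤i+j (sq a) (+ N * sq b) {{nonNegative (+N*sq-nonneg N b)}})
... | yes refl | no b≢0   = <-≤-trans N*sq-b>0 (i≤j+i (+ N * sq b) (sq 0ℤ))
  where
  N*sq-b>0 : 0ℤ < + N * sq b
  N*sq-b>0 = subst (_< + N * sq b) (*-zeroʳ (+ N)) (*-monoˡ-<-pos (+ N) (sq-pos b≢0))

record NearestMultiple² (N : ℕ) (n : ℤ) (w μ : Pt) : Set where
  constructor nearestMultiple²
  field
    minimal² : ∀ ν → dist² N w (scale n μ) ≤ dist² N w (scale n ν)

open NearestMultiple²

nearestMultiple²⇒nearestMultiple : ∀ N .{{_ : ℕ.NonZero N}} {n w μ} → NearestMultiple² N n w μ →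
  NearestMultiple n (proj₁ w) (proj₁ μ) × NearestMultiple n (proj₂ w) (proj₂ μ)
nearestMultiple²⇒nearestMultiple N@(ℕ.suc _) {n} {w₁ , w₂} {μ₁ , μ₂} nearest =
  nearestMultiple (λ k → +-cancelʳ-≤ (+ N * sq (w₂ - n * μ₂)) (minimal² nearest (k , μ₂))) ,
  nearestMultiple (λ k →
    *-cancelˡ-≤-pos _ _ (+ N) (+-cancelˡ-≤ (sq (w₁ - n * μ₁)) (minimal² nearest (μ₁ , k))))

nearestMultiple⇒nearestMultiple² : ∀ N {n w₁ w₂ μ₁ μ₂} →
  NearestMultiple n w₁ μ₁ → NearestMultiple n w₂ μ₂ → NearestMultiple² N n (w₁ , w₂) (μ₁ , μ₂)
nearestMultiple⇒nearestMultiple² N near₁ near₂ = nearestMultiple² λ (k₁ , k₂) →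
  +-mono-≤ (minimal near₁ k₁) (*-monoˡ-≤-nonNeg (+ N) (minimal near₂ k₂))

inVoronoiCell⇒nearestMultiple² : ∀ N α {p x} → InVoronoiCell N α p x →
  ∃ λ μ → mul N α μ ≡ p × NearestMultiple² N (normSq N α) (mul N (conj α) x) μ
inVoronoiCell⇒nearestMultiple² N α {x = x} ((μ , refl) , closest) = μ , refl , nearestMultiple² λ ν →
  subst₂ _≤_ (dist²-mul-conj N α x μ) (dist²-mul-conj N α x ν)
    (*-monoˡ-≤-nonNeg (normSq N α) {{nonNegative (normSq-nonneg N α)}} (closest (mul N α ν) (ν , refl)))

nearestMultiple²⇒inVoronoiCell : ∀ N α {x μ} → 0ℤ < normSq N α →
  NearestMultiple² N (normSq N α) (mul N (conj α) x) μ → InVoronoiCell N α (mul N α μ) x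
nearestMultiple²⇒inVoronoiCell N α {x} {μ} n>0 nearest = (μ , refl) , λ { _ (ν , refl) →
  *-cancelˡ-≤-pos _ _ (normSq N α) {{positive n>0}}
    (subst₂ _≤_ (sym (dist²-mul-conj N α x μ)) (sym (dist²-mul-conj N α x ν)) (minimal² nearest ν)) }

-- The pair on the right is mul N (a , b) (d , 1ℤ) for c = + N, generalised so that parity c can refine c.
-- d ≡ a (mod 2) works whenever a² + c b² is even; the other parity patterns make it odd.
2∣norm⇒halvable : ∀ a b c → + 2 ∣ a * a + c * (b * b) →
  ∃ λ d → Bit d × ∃ λ x → scale (+ 2) x ≡ (a * d - c * (b * 1ℤ) , a * 1ℤ + b * d)
2∣norm⇒halvable a b c 2∣n with parity a | parity b | parity c
... | even A | even B | _ =
  0ℤ , inj₁ refl , (- (c * B) , A) , cong₂ _,_ (first c A B) (second A B)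
  where
  first : ∀ c A B → + 2 * - (c * B) ≡ + 2 * A * 0ℤ - c * (+ 2 * B * 1ℤ)
  first = solve-∀
  second : ∀ A B → + 2 * A ≡ + 2 * A * 1ℤ + + 2 * B * 0ℤ
  second = solve-∀
... | even A | odd B | even M =
  0ℤ , inj₁ refl , (- (M * (+ 2 * B + 1ℤ)) , A) , cong₂ _,_ (first A B M) (second A B)
  where
  first : ∀ A B M → + 2 * - (M * (+ 2 * B + 1ℤ)) ≡ + 2 * A * 0ℤ - + 2 * M * ((+ 2 * B + 1ℤ) * 1ℤ)
  first = solve-∀
  second : ∀ A B → + 2 * A ≡ + 2 * A * 1ℤ + (+ 2 * B + 1ℤ) * 0ℤ
  second = solve-∀
... | even A | odd B | odd M =
  contradiction 2∣n (odd⇒2∤ (+ 2 * A * A + (+ 2 * M + 1ℤ) * (+ 2 * B * B + + 2 * B) + M) (norm≡ A B M))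
  where
  norm≡ : ∀ A B M → + 2 * A * (+ 2 * A) + (+ 2 * M + 1ℤ) * ((+ 2 * B + 1ℤ) * (+ 2 * B + 1ℤ))
    ≡ + 2 * (+ 2 * A * A + (+ 2 * M + 1ℤ) * (+ 2 * B * B + + 2 * B) + M) + 1ℤ
  norm≡ = solve-∀
... | odd A | even B | _ =
  contradiction 2∣n (odd⇒2∤ (+ 2 * A * A + + 2 * A + + 2 * c * B * B) (norm≡ A B c))
  where
  norm≡ : ∀ A B c → (+ 2 * A + 1ℤ) * (+ 2 * A + 1ℤ) + c * (+ 2 * B * (+ 2 * B))
    ≡ + 2 * (+ 2 * A * A + + 2 * A + + 2 * c * B * B) + 1ℤ
  norm≡ = solve-∀
... | odd A | odd B | even M =
  contradiction 2∣n (odd⇒2∤ (+ 2 * A * A + + 2 * A + M * (+ 2 * B + 1ℤ) * (+ 2 * B + 1ℤ)) (norm≡ A B M))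
  where
  norm≡ : ∀ A B M → (+ 2 * A + 1ℤ) * (+ 2 * A + 1ℤ) + + 2 * M * ((+ 2 * B + 1ℤ) * (+ 2 * B + 1ℤ))
    ≡ + 2 * (+ 2 * A * A + + 2 * A + M * (+ 2 * B + 1ℤ) * (+ 2 * B + 1ℤ)) + 1ℤ
  norm≡ = solve-∀
... | odd A | odd B | odd M =
  1ℤ , inj₂ refl , (A - + 2 * M * B - M - B , A + B + 1ℤ) , cong₂ _,_ (first A B M) (second A B)
  where
  first : ∀ A B M →
    + 2 * (A - + 2 * M * B - M - B) ≡ (+ 2 * A + 1ℤ) * 1ℤ - (+ 2 * M + 1ℤ) * ((+ 2 * B + 1ℤ) * 1ℤ)
  first = solve-∀
  second : ∀ A B → + 2 * (A + B + 1ℤ) ≡ (+ 2 * A + 1ℤ) * 1ℤ + (+ 2 * B + 1ℤ) * 1ℤ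
  second = solve-∀

2∤normSq⇒clean : ∀ N .{{_ : ℕ.NonZero N}} α → ¬ (+ 2 ∣ normSq N α) → Clean N α
2∤normSq⇒clean N α 2∤n x (p , q , p≢q , p-cell , q-cell)
  with inVoronoiCell⇒nearestMultiple² N α {x = x} p-cell | inVoronoiCell⇒nearestMultiple² N α {x = x} q-cell
... | μ , refl , μ-nearest | ν , refl , ν-nearest =
  p≢q (cong (mul N α) (cong₂ _,_
    (nearestMultiple-unique 2∤n (proj₁ μ-coords) (proj₁ ν-coords))
    (nearestMultiple-unique 2∤n (proj₂ μ-coords) (proj₂ ν-coords))))
  where
  μ-coords = nearestMultiple²⇒nearestMultiple N μ-nearest
  ν-coords = nearestMultiple²⇒nearestMultiple N ν-nearest

2∣normSq⇒¬clean : ∀ N .{{_ : ℕ.NonZero N}} α → α ≢ (0ℤ , 0ℤ) → + 2 ∣ normSq N α → ¬ Clean N α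
2∣normSq⇒¬clean N α@(a , b) α≢0 2∣n clean
  with 2∣norm⇒halvable a b (+ N) 2∣n | Signed.∣ᵤ⇒∣ 2∣n
... | d , d-bit , x , 2x≡αμ | Signed.divides h n≡h*2 =
  clean x (mul N α (0ℤ , 0ℤ) , mul N α μ , 0≢μ ∘ mul-injective N α ,
           cell (0ℤ , 0ℤ) (proj₁ near₁) (proj₁ near₂) , cell μ (proj₂ near₁) (proj₂ near₂))
  where
  μ = d , 1ℤ
  n>0 = normSq-pos N α α≢0
  instance
    n≢0 : NonZero (normSq N α)
    n≢0 = >-nonZero n>0
  n≡2h : normSq N α ≡ + 2 * h
  n≡2h = trans n≡h*2 (*-comm h (+ 2))
  ᾱx≡hμ : mul N (conj α) x ≡ scale h μ
  ᾱx≡hμ = mul-conj-half N α 2x≡αμ n≡2h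
  near₁ = nearestMultiple-half h d-bit
  near₂ = nearestMultiple-half h (inj₂ refl)
  cell : ∀ ν → NearestMultiple (+ 2 * h) (h * d) (proj₁ ν) → NearestMultiple (+ 2 * h) (h * 1ℤ) (proj₂ ν) →
         InVoronoiCell N α (mul N α ν) x
  cell ν near-x near-y = nearestMultiple²⇒inVoronoiCell N α n>0
    (subst₂ (λ n w → NearestMultiple² N n w ν) (sym n≡2h) (sym ᾱx≡hμ)
      (nearestMultiple⇒nearestMultiple² N near-x near-y))
  0≢μ : (0ℤ , 0ℤ) ≢ μ
  0≢μ 0≡μ with cong proj₂ 0≡μ
  ... | ()

theorem7 : (N : ℕ) → N ≥ 1 → (a b : ℤ) → ¬ ((a , b) ≡ (+ 0 , + 0)) →
    (Clean N (a , b) ⇔ (¬ (+ 2 ∣ (a * a + (+ N) * (b * b)))))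
theorem7 N N≥1 a b α≢0 = mk⇔
  (λ clean 2∣n → 2∣normSq⇒¬clean N (a , b) α≢0 2∣n clean)
  (2∤normSq⇒clean N (a , b))
  where
  instance
    N≢0 : ℕ.NonZero N
    N≢0 = ℕ.>-nonZero N≥1
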